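{- Let $E$ be an elliptic curve over $\mathbb{Q}$ whose conductor $N$ is a prime number. If $N\equiv 7\pmod{8}$, then $a_E(2)=\pm 1$.
   Context: For a prime $p$, $a_E(p)=p+\delta_p-\#E(\mathbb{F}_p)$, where $E(\mathbb{F}_p)$ is the group of points of the reduction modulo $p$ of a global minimal Weierstrass model of $E$, and $\delta_p=0$ if $E$ has bad reduction at $p$ and $\delta_p=1$ otherwise. (Here $N$ odd, so $E$ has good reduction at $2$ and $a_E(2)=3-\#E(\mathbb{F}_2)$.) -}

module Defs where

open import Data.Nat as ℕ using (ℕ)
open import Data.Nat.Primality using (Prime)
open import Data.Integer as ℤ using (ℤ; +_; -[1+_]; _+_; _*_; _-_; -_; ∣_∣; _%_)
open import Data.Integer.Divisibility as ℤDiv using ()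
open import Data.Rational as ℚ using (ℚ)
open import Data.List using (List; []; _∷_; map)
open import Data.Nat.ListAction using (sum)
open import Data.Product using (_×_; _,_)
open import Relation.Binary.PropositionalEquality using (_≡_; _≢_)
open import Relation.Nullary using (¬_)

-- A Weierstrass model  y² + a1 x y + a3 y = x³ + a2 x² + a4 x + a6
-- with integer coefficients.
record Weierstrass : Set where
  constructor mkW
  field
    a1 a2 a3 a4 a6 : ℤ
open Weierstrass public

-- Standard invariants (Silverman III.1).
b2 b4 b6 b8 c4 disc : Weierstrass → ℤ
b2 E = a1 E * a1 E + + 4 * a2 E
b4 E = + 2 * a4 E + a1 E * a3 E
b6 E = a3 E * a3 E + + 4 * a6 E
b8 E = a1 E * a1 E * a6 E + + 4 * a2 E * a6 E - a1 E * a3 E * a4 E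
       + a2 E * a3 E * a3 E - a4 E * a4 E
c4 E = b2 E * b2 E - + 24 * b4 E
disc E = - (b2 E * b2 E * b8 E) - + 8 * (b4 E * b4 E * b4 E)
         - + 27 * (b6 E * b6 E) + + 9 * b2 E * b4 E * b6 E

IsElliptic : Weierstrass → Set
IsElliptic E = disc E ≢ + 0

⟦_⟧ : ℤ → ℚ
⟦ z ⟧ = z ℚ./ 1

-- E' is obtained from E by the change of variables
--   x = u² x' + r,  y = u³ y' + s u² x' + t   (u,r,s,t ∈ ℚ, u ≠ 0)
-- (Silverman, Table III.1.2).
IsChangeOfVariables : Weierstrass → Weierstrass → (u r s t : ℚ) → Set
IsChangeOfVariables E E' u r s t =
  (u ≢ ℚ.0ℚ)
  × (u ℚ.* A1' ≡ A1 ℚ.+ two ℚ.* s)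
  × (u ℚ.* u ℚ.* A2' ≡ A2 ℚ.- s ℚ.* A1 ℚ.+ three ℚ.* r ℚ.- s ℚ.* s)
  × (u ℚ.* u ℚ.* u ℚ.* A3' ≡ A3 ℚ.+ r ℚ.* A1 ℚ.+ two ℚ.* t)
  × (u ℚ.* u ℚ.* u ℚ.* u ℚ.* A4'
       ≡ A4 ℚ.- s ℚ.* A3 ℚ.+ two ℚ.* r ℚ.* A2 ℚ.- (t ℚ.+ r ℚ.* s) ℚ.* A1
            ℚ.+ three ℚ.* r ℚ.* r ℚ.- two ℚ.* s ℚ.* t)
  × (u ℚ.* u ℚ.* u ℚ.* u ℚ.* u ℚ.* u ℚ.* A6'
       ≡ A6 ℚ.+ r ℚ.* A4 ℚ.+ r ℚ.* r ℚ.* A2 ℚ.+ r ℚ.* r ℚ.* r ℚ.- t ℚ.* A3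
            ℚ.- t ℚ.* t ℚ.- r ℚ.* t ℚ.* A1)
  where
    two three : ℚ
    two = ⟦ + 2 ⟧
    three = ⟦ + 3 ⟧
    A1 = ⟦ a1 E ⟧ ; A2 = ⟦ a2 E ⟧ ; A3 = ⟦ a3 E ⟧ ; A4 = ⟦ a4 E ⟧ ; A6 = ⟦ a6 E ⟧
    A1' = ⟦ a1 E' ⟧ ; A2' = ⟦ a2 E' ⟧ ; A3' = ⟦ a3 E' ⟧ ; A4' = ⟦ a4 E' ⟧ ; A6' = ⟦ a6 E' ⟧

IsGlobalMinimal : Weierstrass → Set
IsGlobalMinimal E =
  ∀ (E' : Weierstrass) (u r s t : ℚ) → IsChangeOfVariables E E' u r s t →
  ∣ disc E ∣ ℕ.≤ ∣ disc E' ∣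

GoodReductionAt : Weierstrass → ℕ → Set
GoodReductionAt E p = ¬ ((+ p) ℤDiv.∣ disc E)

MultiplicativeReductionAt : Weierstrass → ℕ → Set
MultiplicativeReductionAt E p = ((+ p) ℤDiv.∣ disc E) × ¬ ((+ p) ℤDiv.∣ c4 E)

-- For a global minimal model E, the conductor of E equals the prime N:
-- the conductor exponent is 0 at every prime p ≠ N (good reduction) and
-- 1 at N (multiplicative reduction).
ConductorIsPrime : Weierstrass → ℕ → Set
ConductorIsPrime E N =
  Prime N
  × (∀ p → Prime p → p ≢ N → GoodReductionAt E p)
  × MultiplicativeReductionAt E N

-- Number of points of the reduction mod 2 (affine points over F₂ plus ∞).
weq : Weierstrass → ℤ → ℤ → ℤ
weq E x y = y * y + a1 E * x * y + a3 E * y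
            - (x * x * x + a2 E * x * x + a4 E * x + a6 E)

indicatorEven : ℤ → ℕ
indicatorEven z with z % (+ 2)
... | ℕ.zero = 1
... | ℕ.suc _ = 0

#E-F2 : Weierstrass → ℕ
#E-F2 E = ℕ.suc (sum (map (λ { (x , y) → indicatorEven (weq E x y) })
                       ((+ 0 , + 0) ∷ (+ 0 , + 1) ∷ (+ 1 , + 0) ∷ (+ 1 , + 1) ∷ [])))

-- a_E(2) = 3 - #E(F₂)   (good reduction at 2)
aE2 : Weierstrass → ℤ
aE2 E = + 3 - + (#E-F2 E)

-- Good reduction away from N leaves N as the only prime factor of Δ, so Δ ≡ ±1 (mod 8)
-- because N ≡ -1 (mod 8). This forces a₁ to be odd: if a₁ and a₃ are both even then
-- 2 ∣ Δ, against good reduction at 2, and if a₁ is even and a₃ odd then b₂ ≡ 0 (mod 4),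
-- b₄ ≡ 0 (mod 2), b₆ ≡ 1 (mod 4), whence Δ ≡ 5 (mod 8). For odd a₁ there is exactly one
-- x ∈ F₂ with a₁x + a₃ = 0; over it the equation in y reads y² = c, with one solution,
-- and over the other x it reads y² + y = c, with none or two. So #E(F₂) ∈ {2, 4} and
-- a_E(2) = ±1; as #E(F₂) only depends on the coefficients mod 2, this is checked on the
-- sixteen models with a₁ = 1 and the other coefficients in {0, 1}.
{-# OPTIONS --safe #-}
module Submission where

open import Defs
open import Data.Bool using (Bool; true; false)
open import Data.Empty using (⊥-elim)
open import Data.Integer using (ℤ; +_; -_; -[1+_]; _+_; _-_; _*_; _%ℕ_; _/ℕ_)
open import Data.Integer.DivMod using (a≡a%ℕn+[a/ℕn]*n; n%ℕd<d)
import Data.Integer.Divisibility as ℤ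
import Data.Integer.Divisibility.Signed as ℤˢ
open import Data.Integer.Properties using (pos-*; +-identityʳ)
open import Data.Integer.Tactic.RingSolver using (solve)
open import Data.List using ([]; _∷_)
open import Data.List.Properties using (map-cong)
open import Data.List.Relation.Unary.All as All using (All)
open import Data.Nat using (ℕ; suc; s≤s; _%_; _≟_; NonZero)
import Data.Nat.Divisibility as ℕ
open import Data.Nat.ListAction using (sum; product)
open import Data.Nat.ListAction.Properties using (∈⇒∣product)
open import Data.Nat.Primality using (Prime; prime[2])
open import Data.Nat.Primality.Factorisation using (factorise; PrimeFactorisation)
open import Data.Product using (∃-syntax; _×_; _,_)
open import Data.Sum using (_⊎_; inj₁; inj₂)
open import Function using (_∘_)
open import Relation.Binary.PropositionalEquality using (_≡_; _≢_; refl; sym; cong; subst)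
open import Relation.Nullary using (¬_; yes; no)
open import Relation.Nullary.Decidable using (toWitnessFalse)

infix 4 _≡_mod_
infixr 4 _,_

record _≡_mod_ (a b m : ℤ) : Set where
  constructor _,_
  field
    quotient : ℤ
    equation : a ≡ b + quotient * m

module _ {m : ℤ} where

  mod-refl : ∀ {a} → a ≡ a mod m
  mod-refl {a} = + 0 , solve (a ∷ m ∷ [])

  mod-sym : ∀ {a b} → a ≡ b mod m → b ≡ a mod m
  mod-sym {b = b} (k , refl) = - k , solve (b ∷ k ∷ m ∷ [])

  mod-trans : ∀ {a b c} → a ≡ b mod m → b ≡ c mod m → a ≡ c mod m
  mod-trans {c = c} (k , refl) (l , refl) = l + k , solve (c ∷ k ∷ l ∷ m ∷ [])

  +-cong-mod : ∀ {a b c d} → a ≡ b mod m → c ≡ d mod m → a + c ≡ b + d mod m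
  +-cong-mod {b = b} {d = d} (k , refl) (l , refl) =
    k + l , solve (b ∷ d ∷ k ∷ l ∷ m ∷ [])

  *-cong-mod : ∀ {a b c d} → a ≡ b mod m → c ≡ d mod m → a * c ≡ b * d mod m
  *-cong-mod {b = b} {d = d} (k , refl) (l , refl) =
    k * d + b * l + k * l * m , solve (b ∷ d ∷ k ∷ l ∷ m ∷ [])

  *-congʳ-mod : ∀ {a b c} → a ≡ b mod m → a * c ≡ b * c mod m
  *-congʳ-mod a≡b = *-cong-mod a≡b mod-refl

  -‿cong-mod : ∀ {a b} → a ≡ b mod m → - a ≡ - b mod m
  -‿cong-mod {b = b} (k , refl) = - k , solve (b ∷ k ∷ m ∷ [])

  mod⇒∣ : ∀ {a b} → a ≡ b mod m → m ℤ.∣ a - b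
  mod⇒∣ {b = b} (k , refl) =
    ℤˢ.∣⇒∣ᵤ {m} {b + k * m - b} (ℤˢ.divides k (solve (b ∷ k ∷ m ∷ [])))

  ≡0-mod⇒∣ : ∀ {a} → a ≡ + 0 mod m → m ℤ.∣ a
  ≡0-mod⇒∣ {a} a≡0 = subst (m ℤ.∣_) (+-identityʳ a) (mod⇒∣ a≡0)

mod-weaken : ∀ {a b} m n → a ≡ b mod m * n → a ≡ b mod m
mod-weaken {b = b} m n (k , refl) = k * n , solve (b ∷ k ∷ m ∷ n ∷ [])

≡-%ℕ : ∀ a n .{{_ : NonZero n}} → a ≡ + (a %ℕ n) mod + n
≡-%ℕ a n = a /ℕ n , a≡a%ℕn+[a/ℕn]*n a n

1≢0-mod-2 : ¬ (+ 1 ≡ + 0 mod + 2)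
1≢0-mod-2 1≡0 = toWitnessFalse {a? = 2 ℕ.∣? 1} _ (mod⇒∣ 1≡0)

%ℕ2-cong : ∀ {a b} → a ≡ b mod + 2 → a %ℕ 2 ≡ b %ℕ 2
%ℕ2-cong {a} {b} a≡b
  with a %ℕ 2 | ≡-%ℕ a 2 | n%ℕd<d a 2 | b %ℕ 2 | ≡-%ℕ b 2 | n%ℕd<d b 2
... | 0 | _ | _ | 0 | _ | _ = refl
... | 1 | _ | _ | 1 | _ | _ = refl
... | 0 | a≡0 | _ | 1 | b≡1 | _ =
  ⊥-elim (1≢0-mod-2 (mod-trans (mod-sym b≡1) (mod-trans (mod-sym a≡b) a≡0)))
... | 1 | a≡1 | _ | 0 | b≡0 | _ =
  ⊥-elim (1≢0-mod-2 (mod-trans (mod-sym a≡1) (mod-trans a≡b b≡0)))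
... | suc (suc _) | _ | s≤s (s≤s ()) | _ | _ | _
... | _ | _ | _ | suc (suc _) | _ | s≤s (s≤s ())

indicatorEven-cong : ∀ {a b} → a ≡ b mod + 2 → indicatorEven a ≡ indicatorEven b
indicatorEven-cong {a} {b} a≡b with a %ℕ 2 | b %ℕ 2 | %ℕ2-cong a≡b
... | r | .r | refl = refl

bit : Bool → ℤ
bit false = + 0
bit true  = + 1

parity : ∀ a → ∃[ b ] a ≡ bit b mod + 2
parity a with a %ℕ 2 | ≡-%ℕ a 2 | n%ℕd<d a 2
... | 0 | a≡0 | _ = false , a≡0
... | 1 | a≡1 | _ = true , a≡1
... | suc (suc _) | _ | s≤s (s≤s ())

infix 4 _≋_mod_

record _≋_mod_ (E F : Weierstrass) (m : ℤ) : Set where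
  field
    a1-cong : a1 E ≡ a1 F mod m
    a2-cong : a2 E ≡ a2 F mod m
    a3-cong : a3 E ≡ a3 F mod m
    a4-cong : a4 E ≡ a4 F mod m
    a6-cong : a6 E ≡ a6 F mod m

weq-cong : ∀ {m E F} → E ≋ F mod m → ∀ x y → weq E x y ≡ weq F x y mod m
weq-cong {m} {E} {F} E≋F x y = +-cong-mod lhs-cong (-‿cong-mod rhs-cong)
  where
  open _≋_mod_ E≋F
  lhs-cong : y * y + a1 E * x * y + a3 E * y ≡ y * y + a1 F * x * y + a3 F * y mod m
  lhs-cong = +-cong-mod (+-cong-mod (mod-refl {a = y * y})
                                    (*-congʳ-mod {c = y} (*-congʳ-mod {c = x} a1-cong)))
                        (*-congʳ-mod {c = y} a3-cong)
  rhs-cong : x * x * x + a2 E * x * x + a4 E * x + a6 E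
           ≡ x * x * x + a2 F * x * x + a4 F * x + a6 F mod m
  rhs-cong = +-cong-mod (+-cong-mod (+-cong-mod (mod-refl {a = x * x * x})
                                                (*-congʳ-mod {c = x} (*-congʳ-mod {c = x} a2-cong)))
                                    (*-congʳ-mod {c = x} a4-cong))
                        a6-cong

#E-F2-cong : ∀ {E F} → E ≋ F mod + 2 → #E-F2 E ≡ #E-F2 F
#E-F2-cong {E} {F} E≋F = cong (suc ∘ sum)
  (map-cong {f = onCurve E} {g = onCurve F} (λ (x , y) → indicatorEven-cong (weq-cong E≋F x y))
    ((+ 0 , + 0) ∷ (+ 0 , + 1) ∷ (+ 1 , + 0) ∷ (+ 1 , + 1) ∷ []))
  where
  onCurve : Weierstrass → ℤ × ℤ → ℕ
  onCurve E (x , y) = indicatorEven (weq E x y)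

aE2-cong : ∀ {E F} → E ≋ F mod + 2 → aE2 E ≡ aE2 F
aE2-cong E≋F = cong (λ n → + 3 - + n) (#E-F2-cong E≋F)

infix 4 _≡±1

_≡±1 : ℤ → Set
a ≡±1 = a ≡ + 1 ⊎ a ≡ - + 1

bitModel : Bool → Bool → Bool → Bool → Bool → Weierstrass
bitModel b₁ b₂ b₃ b₄ b₆ = mkW (bit b₁) (bit b₂) (bit b₃) (bit b₄) (bit b₆)

bitModel-aE2≡±1 : ∀ b₂ b₃ b₄ b₆ → aE2 (bitModel true b₂ b₃ b₄ b₆) ≡±1
bitModel-aE2≡±1 false false false false = inj₁ refl
bitModel-aE2≡±1 false false false true  = inj₂ refl
bitModel-aE2≡±1 false false true  false = inj₂ refl
bitModel-aE2≡±1 false false true  true  = inj₁ refl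
bitModel-aE2≡±1 false true  false false = inj₂ refl
bitModel-aE2≡±1 false true  false true  = inj₁ refl
bitModel-aE2≡±1 false true  true  false = inj₂ refl
bitModel-aE2≡±1 false true  true  true  = inj₁ refl
bitModel-aE2≡±1 true  false false false = inj₂ refl
bitModel-aE2≡±1 true  false false true  = inj₁ refl
bitModel-aE2≡±1 true  false true  false = inj₁ refl
bitModel-aE2≡±1 true  false true  true  = inj₂ refl
bitModel-aE2≡±1 true  true  false false = inj₂ refl
bitModel-aE2≡±1 true  true  false true  = inj₁ refl
bitModel-aE2≡±1 true  true  true  false = inj₂ refl
bitModel-aE2≡±1 true  true  true  true  = inj₁ refl

a1-odd⇒aE2≡±1 : ∀ E → a1 E ≡ + 1 mod + 2 → aE2 E ≡±1
a1-odd⇒aE2≡±1 E a1≡1 with parity (a2 E) | parity (a3 E) | parity (a4 E) | parity (a6 E)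
... | b₂ , a2≡b₂ | b₃ , a3≡b₃ | b₄ , a4≡b₄ | b₆ , a6≡b₆ =
  subst _≡±1 (sym (aE2-cong E≋F)) (bitModel-aE2≡±1 b₂ b₃ b₄ b₆)
  where
  E≋F : E ≋ bitModel true b₂ b₃ b₄ b₆ mod + 2
  E≋F = record { a1-cong = a1≡1 ; a2-cong = a2≡b₂ ; a3-cong = a3≡b₃
               ; a4-cong = a4≡b₄ ; a6-cong = a6≡b₆ }

x²+4y≡0-mod-4 : ∀ {x} y → x ≡ + 0 mod + 2 → x * x + + 4 * y ≡ + 0 mod + 4
x²+4y≡0-mod-4 y (k , refl) = k * k + y , solve (k ∷ y ∷ [])

x²+4y≡1-mod-4 : ∀ {x} y → x ≡ + 1 mod + 2 → x * x + + 4 * y ≡ + 1 mod + 4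
x²+4y≡1-mod-4 y (k , refl) = k * k + k + y , solve (k ∷ y ∷ [])

2z+xy≡0-mod-2 : ∀ {x} y z → x ≡ + 0 mod + 2 → + 2 * z + x * y ≡ + 0 mod + 2
2z+xy≡0-mod-2 y z (k , refl) = z + k * y , solve (k ∷ y ∷ z ∷ [])

-- The discriminant in terms of b₂, b₄, b₆, b₈, spelled out (rather than through disc)
-- so that the ring solver sees the polynomial.
disc-formula≡0-mod-2 : ∀ {b₂ b₄ b₆} b₈ →
  b₂ ≡ + 0 mod + 2 → b₄ ≡ + 0 mod + 2 → b₆ ≡ + 0 mod + 2 →
  - (b₂ * b₂ * b₈) - + 8 * (b₄ * b₄ * b₄) - + 27 * (b₆ * b₆) + + 9 * b₂ * b₄ * b₆ ≡ + 0 mod + 2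
disc-formula≡0-mod-2 b₈ (u , refl) (v , refl) (w , refl) =
  - (+ 2 * u * u * b₈) - + 32 * (v * v * v) - + 54 * (w * w) + + 36 * u * v * w ,
  solve (u ∷ v ∷ w ∷ b₈ ∷ [])

disc-formula≡5-mod-8 : ∀ {b₂ b₄ b₆} b₈ →
  b₂ ≡ + 0 mod + 4 → b₄ ≡ + 0 mod + 2 → b₆ ≡ + 1 mod + 4 →
  - (b₂ * b₂ * b₈) - + 8 * (b₄ * b₄ * b₄) - + 27 * (b₆ * b₆) + + 9 * b₂ * b₄ * b₆ ≡ + 5 mod + 8
disc-formula≡5-mod-8 b₈ (u , refl) (v , refl) (w , refl) =
  - (+ 2 * u * u * b₈) - + 8 * (v * v * v) - + 54 * (w * w) - + 27 * w
    + + 9 * u * v * (+ 1 + w * + 4) - + 4 ,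
  solve (u ∷ v ∷ w ∷ b₈ ∷ [])

disc-even : ∀ E → a1 E ≡ + 0 mod + 2 → a3 E ≡ + 0 mod + 2 → + 2 ℤ.∣ disc E
disc-even E a1≡0 a3≡0 = ≡0-mod⇒∣ (disc-formula≡0-mod-2 (b8 E)
  (mod-weaken (+ 2) (+ 2) (x²+4y≡0-mod-4 (a2 E) a1≡0))
  (2z+xy≡0-mod-2 (a3 E) (a4 E) a1≡0)
  (mod-weaken (+ 2) (+ 2) (x²+4y≡0-mod-4 (a6 E) a3≡0)))

disc≡5-mod-8 : ∀ E → a1 E ≡ + 0 mod + 2 → a3 E ≡ + 1 mod + 2 → disc E ≡ + 5 mod + 8
disc≡5-mod-8 E a1≡0 a3≡1 = disc-formula≡5-mod-8 (b8 E)
  (x²+4y≡0-mod-4 (a2 E) a1≡0)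
  (2z+xy≡0-mod-2 (a3 E) (a4 E) a1≡0)
  (x²+4y≡1-mod-4 (a6 E) a3≡1)

infix 4 _≡±1-mod_

_≡±1-mod_ : ℤ → ℤ → Set
a ≡±1-mod m = a ≡ + 1 mod m ⊎ a ≡ - + 1 mod m

module _ {m : ℤ} where

  ≡±1-mod-* : ∀ {a b} → a ≡±1-mod m → b ≡±1-mod m → a * b ≡±1-mod m
  ≡±1-mod-* (inj₁ a≡1)  (inj₁ b≡1)  = inj₁ (*-cong-mod a≡1 b≡1)
  ≡±1-mod-* (inj₁ a≡1)  (inj₂ b≡-1) = inj₂ (*-cong-mod a≡1 b≡-1)
  ≡±1-mod-* (inj₂ a≡-1) (inj₁ b≡1)  = inj₂ (*-cong-mod a≡-1 b≡1)
  ≡±1-mod-* (inj₂ a≡-1) (inj₂ b≡-1) = inj₁ (*-cong-mod a≡-1 b≡-1)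

  ≡±1-mod-neg : ∀ {a} → a ≡±1-mod m → - a ≡±1-mod m
  ≡±1-mod-neg (inj₁ a≡1)  = inj₂ (-‿cong-mod a≡1)
  ≡±1-mod-neg (inj₂ a≡-1) = inj₁ (-‿cong-mod a≡-1)

  ≡±1-mod-product : ∀ {ps} → All (λ p → + p ≡±1-mod m) ps → + product ps ≡±1-mod m
  ≡±1-mod-product All.[] = inj₁ mod-refl
  ≡±1-mod-product {p ∷ ps} (p≡±1 All.∷ ps≡±1) =
    subst (_≡±1-mod m) (sym (pos-* p (product ps)))
      (≡±1-mod-* p≡±1 (≡±1-mod-product ps≡±1))

  pos-prime-factors-≡±1-mod : ∀ n .{{_ : NonZero n}} →
    (∀ p → Prime p → p ℕ.∣ n → + p ≡±1-mod m) → + n ≡±1-mod m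
  pos-prime-factors-≡±1-mod n h = subst (λ k → + k ≡±1-mod m) (sym isFactorisation)
    (≡±1-mod-product (All.tabulate λ {p} p∈factors →
      h p (All.lookup factorsPrime p∈factors)
          (subst (p ℕ.∣_) (sym isFactorisation) (∈⇒∣product p∈factors))))
    where open PrimeFactorisation (factorise n)

  prime-factors-≡±1-mod : ∀ d → d ≢ + 0 →
    (∀ p → Prime p → + p ℤ.∣ d → + p ≡±1-mod m) → d ≡±1-mod m
  prime-factors-≡±1-mod (+ 0)     d≢0 _ = ⊥-elim (d≢0 refl)
  prime-factors-≡±1-mod (+ suc n) _   h = pos-prime-factors-≡±1-mod (suc n) h
  prime-factors-≡±1-mod -[1+ n ]  _   h = ≡±1-mod-neg (pos-prime-factors-≡±1-mod (suc n) h)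

≡7-mod-8⇒≢2 : ∀ {N} → N % 8 ≡ 7 → 2 ≢ N
≡7-mod-8⇒≢2 () refl

≡7-mod-8⇒≡-1-mod-8 : ∀ {N} → N % 8 ≡ 7 → + N ≡ - + 1 mod + 8
≡7-mod-8⇒≡-1-mod-8 {N} N%8≡7 =
  mod-trans (subst (λ r → + N ≡ + r mod + 8) N%8≡7 (≡-%ℕ (+ N) 8)) (+ 1 , refl)

≡5-mod-8⇒≢±1 : ∀ {a} → a ≡ + 5 mod + 8 → ¬ (a ≡±1-mod + 8)
≡5-mod-8⇒≢±1 a≡5 (inj₁ a≡1)  =
  toWitnessFalse {a? = 8 ℕ.∣? 4} _ (mod⇒∣ (mod-trans (mod-sym a≡5) a≡1))
≡5-mod-8⇒≢±1 a≡5 (inj₂ a≡-1) =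
  toWitnessFalse {a? = 8 ℕ.∣? 6} _ (mod⇒∣ (mod-trans (mod-sym a≡5) a≡-1))

disc≡±1-mod-8 : ∀ E N → IsElliptic E → (∀ p → Prime p → p ≢ N → GoodReductionAt E p) →
                N % 8 ≡ 7 → disc E ≡±1-mod + 8
disc≡±1-mod-8 E N Δ≢0 good N%8≡7 = prime-factors-≡±1-mod (disc E) Δ≢0 prime-factor-≡±1
  where
  prime-factor-≡±1 : ∀ p → Prime p → + p ℤ.∣ disc E → + p ≡±1-mod + 8
  prime-factor-≡±1 p p-prime p∣Δ with p ≟ N
  ... | yes refl = inj₂ (≡7-mod-8⇒≡-1-mod-8 N%8≡7)
  ... | no p≢N   = ⊥-elim (good p p-prime p≢N p∣Δ)

mainTheorem1 : (E : Weierstrass) (N : ℕ) → IsElliptic E → IsGlobalMinimal E →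
    ConductorIsPrime E N → N % 8 ≡ 7 →
    (aE2 E ≡ + 1) ⊎ (aE2 E ≡ - (+ 1))
mainTheorem1 E N Δ≢0 _ (_ , good , _) N%8≡7 with parity (a1 E) | parity (a3 E)
... | true  , a1≡1 | _            = a1-odd⇒aE2≡±1 E a1≡1
... | false , a1≡0 | false , a3≡0 =
  ⊥-elim (good 2 prime[2] (≡7-mod-8⇒≢2 N%8≡7) (disc-even E a1≡0 a3≡0))
... | false , a1≡0 | true  , a3≡1 =
  ⊥-elim (≡5-mod-8⇒≢±1 (disc≡5-mod-8 E a1≡0 a3≡1) (disc≡±1-mod-8 E N Δ≢0 good N%8≡7))
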